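{- Let $X$ be a $k$-regular connected graph with a nonempty set $S$ of marked vertices. If an automorphism of $X$ that fixes $S$ setwise sends $a$ to $b$ and $u$ to $v$, then $\widehat{M}_{u,a}=\widehat{M}_{v,b}$.
   Context: Arcs are ordered pairs $(u,v)$ of adjacent vertices; $R$ is the arc-reversal matrix; $D_t$ is the tail incidence matrix ($(D_t)_{x,(u,v)}=1$ iff $x=u$); $O_S$ is the identity with $[S,S]$ block zeroed; $U=R\left(\frac2kD_t^TO_SD_t-I\right)$. The average vertex mixing matrix is $\widehat{M}_{u,v}=\lim_{T\to\infty}\frac1T\sum_{t=0}^{T-1}\sum_{w\sim u}|(U^tx_v)_{(u,w)}|^2$ with $x_v=k^{ -1/2}D_t^Te_v$. -}

module Defs where

open import Data.Nat as ℕ using (ℕ; zero; suc)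
open import Data.Integer using (+_)
open import Data.Fin as F using (Fin; _≟_)
open import Data.Bool using (Bool; true; false; if_then_else_; not)
open import Data.Rational using (ℚ; 0ℚ; 1ℚ; _+_; _*_; _-_; _/_; _<_; ∣_∣)
open import Data.Product using (∃; _×_)
open import Relation.Binary.PropositionalEquality using (_≡_)
open import Relation.Nullary using (does)

ΣV : (n : ℕ) → (Fin n → ℚ) → ℚ
ΣV zero f = 0ℚ
ΣV (suc n) f = f F.zero + ΣV n (λ i → f (F.suc i))

ΣVℕ : (n : ℕ) → (Fin n → ℕ) → ℕ
ΣVℕ zero f = 0
ΣVℕ (suc n) f = f F.zero ℕ.+ ΣVℕ n (λ i → f (F.suc i))

Σt : ℕ → (ℕ → ℚ) → ℚ
Σt zero f = 0ℚ
Σt (suc T) f = Σt T f + f T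

⟦_⟧ : Bool → ℚ
⟦ b ⟧ = if b then 1ℚ else 0ℚ

-- 1/k as a rational (convention 1/0 = 0; only relevant when k = 0,
-- in which case there are no arcs at all).
recip : ℕ → ℚ
recip zero = 0ℚ
recip (suc m) = + 1 / suc m

IsSimpleGraph : (n : ℕ) → (Fin n → Fin n → Bool) → Set
IsSimpleGraph n A = (∀ x y → A x y ≡ A y x) × (∀ x → A x x ≡ false)

degree : (n : ℕ) → (Fin n → Fin n → Bool) → Fin n → ℕ
degree n A x = ΣVℕ n (λ y → if A x y then 1 else 0)

IsRegular : (n : ℕ) → (Fin n → Fin n → Bool) → ℕ → Set
IsRegular n A k = ∀ x → degree n A x ≡ k

data Reach {n : ℕ} (A : Fin n → Fin n → Bool) : Fin n → Fin n → Set where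
  here : ∀ {x} → Reach A x x
  step : ∀ {x y z} → A x y ≡ true → Reach A y z → Reach A x z

IsConnected : (n : ℕ) → (Fin n → Fin n → Bool) → Set
IsConnected n A = ∀ x y → Reach A x y

-- Functions on arcs: f u w is the entry at arc (u,w); values at non-arcs
-- are never read.

ArcFn : ℕ → Set
ArcFn n = Fin n → Fin n → ℚ

-- U = R ((2/k) D_tᵀ O_S D_t − I), S given by its indicator S : Fin n → Bool.
-- (U f)(u,w) = (2/k) [w ∉ S] Σ_{w' ∼ w} f(w,w') − f(w,u).
Uop : (n k : ℕ) → (Fin n → Fin n → Bool) → (Fin n → Bool) → ArcFn n → ArcFn n
Uop n k A S f u w =
  ((+ 2 / 1) * recip k) * ⟦ not (S w) ⟧ * ΣV n (λ w' → ⟦ A w w' ⟧ * f w w')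
  - f w u

Upow : (n k : ℕ) → (Fin n → Fin n → Bool) → (Fin n → Bool) → ℕ → ArcFn n → ArcFn n
Upow n k A S zero f = f
Upow n k A S (suc t) f = Uop n k A S (Upow n k A S t f)

-- y_v = D_tᵀ e_v  (so x_v = k^{-1/2} y_v)
yv : (n : ℕ) → Fin n → ArcFn n
yv n v u w = ⟦ does (u ≟ v) ⟧

-- Σ_{w ∼ u} |(U^t x_v)_{(u,w)}|² = (1/k) Σ_{w ∼ u} ((U^t y_v)_{(u,w)})²
mixTerm : (n k : ℕ) → (Fin n → Fin n → Bool) → (Fin n → Bool) → ℕ → Fin n → Fin n → ℚ
mixTerm n k A S t u v =
  recip k * ΣV n (λ w → ⟦ A u w ⟧ * (Upow n k A S t (yv n v) u w * Upow n k A S t (yv n v) u w))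

-- Cesàro average (1/T) Σ_{t=0}^{T-1} mixTerm, for T = suc m ≥ 1.
avgMix : (n k : ℕ) → (Fin n → Fin n → Bool) → (Fin n → Bool) → ℕ → Fin n → Fin n → ℚ
avgMix n k A S m u v = recip (suc m) * Σt (suc m) (λ t → mixTerm n k A S t u v)

-- Equality of the limits M̂_{u,a} = M̂_{v,b}: the Cesàro averages
-- have the same limit, i.e. their difference tends to 0.
SameLimit : (ℕ → ℚ) → (ℕ → ℚ) → Set
SameLimit f g = ∀ (ε : ℚ) → 0ℚ < ε → ∃ λ N → ∀ m → N ℕ.≤ m → ∣ f m - g m ∣ < ε

-- An automorphism σ of X that fixes S setwise commutes with the walk operator U, which is
-- built from the adjacency relation and from S only; it also maps the initial state of a to
-- that of σ a. Hence (Uᵗ y_{σa})(σu, σw) = (Uᵗ y_a)(u, w) for every t, so the Cesàro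
-- averages defining M̂_{σu,σa} and M̂_{u,a} coincide for every T, and so do their limits.
module Submission where

open import Defs
open import Data.Nat using (ℕ; zero; suc)
open import Data.Fin using (Fin; _≟_)
import Data.Fin as F
open import Data.Bool using (Bool; true; not)
open import Data.Product using (∃; _,_)
open import Data.Fin.Permutation using (Permutation′; _⟨$⟩ʳ_; _⟨$⟩ˡ_; inverseˡ)
open import Data.Integer using (+_)
open import Data.Rational using (ℚ; 0ℚ; _/_; _+_; _*_; _-_; ∣_∣; _<_)
import Data.Rational.Properties as ℚ
open import Function.Bundles using (mk⇔)
open import Relation.Binary.PropositionalEquality
open import Relation.Nullary.Decidable using (does-⇔)
open import Algebra.Properties.CommutativeMonoid.Sum ℚ.+-0-commutativeMonoid
  using (sum; sum-permute)

ΣV-cong : ∀ n {f g : Fin n → ℚ} → (∀ i → f i ≡ g i) → ΣV n f ≡ ΣV n g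
ΣV-cong zero    f≗g = refl
ΣV-cong (suc n) f≗g = cong₂ _+_ (f≗g F.zero) (ΣV-cong n (λ i → f≗g (F.suc i)))

ΣV≡sum : ∀ n (f : Fin n → ℚ) → ΣV n f ≡ sum f
ΣV≡sum zero    f = refl
ΣV≡sum (suc n) f = cong (_+_ (f F.zero)) (ΣV≡sum n (λ i → f (F.suc i)))

ΣV-permute : ∀ n (σ : Permutation′ n) (f : Fin n → ℚ) →
             ΣV n f ≡ ΣV n (λ i → f (σ ⟨$⟩ʳ i))
ΣV-permute n σ f = begin
  ΣV n f                     ≡⟨ ΣV≡sum n f ⟩
  sum f                      ≡⟨ sum-permute f σ ⟩
  sum (λ i → f (σ ⟨$⟩ʳ i))   ≡⟨ ΣV≡sum n _ ⟨
  ΣV n (λ i → f (σ ⟨$⟩ʳ i))  ∎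
  where open ≡-Reasoning

Σt-cong : ∀ T {f g : ℕ → ℚ} → (∀ t → f t ≡ g t) → Σt T f ≡ Σt T g
Σt-cong zero    f≗g = refl
Σt-cong (suc T) f≗g = cong₂ _+_ (Σt-cong T f≗g) (f≗g T)

sameLimit-≗ : {f g : ℕ → ℚ} → (∀ m → f m ≡ g m) → SameLimit f g
sameLimit-≗ {f} {g} f≗g ε ε>0 = 0 , λ m _ → subst (λ d → ∣ d ∣ < ε) (sym (f-g≡0 m)) ε>0
  where
  f-g≡0 : ∀ m → f m - g m ≡ 0ℚ
  f-g≡0 m = trans (cong (f m -_) (sym (f≗g m))) (ℚ.+-inverseʳ (f m))

module Automorphism
  (n k : ℕ) (A : Fin n → Fin n → Bool) (S : Fin n → Bool) (σ : Permutation′ n)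
  (σ-preserves-A : ∀ x y → A (σ ⟨$⟩ʳ x) (σ ⟨$⟩ʳ y) ≡ A x y)
  (σ-preserves-S : ∀ x → S (σ ⟨$⟩ʳ x) ≡ S x)
  where

  σ-injective : ∀ {x y} → σ ⟨$⟩ʳ x ≡ σ ⟨$⟩ʳ y → x ≡ y
  σ-injective {x} {y} σx≡σy =
    trans (sym (inverseˡ σ)) (trans (cong (σ ⟨$⟩ˡ_) σx≡σy) (inverseˡ σ))

  yv-equivariant : ∀ a x y → yv n (σ ⟨$⟩ʳ a) (σ ⟨$⟩ʳ x) (σ ⟨$⟩ʳ y) ≡ yv n a x y
  yv-equivariant a x y =
    cong ⟦_⟧ (does-⇔ (mk⇔ σ-injective (cong (σ ⟨$⟩ʳ_))) (σ ⟨$⟩ʳ x ≟ σ ⟨$⟩ʳ a) (x ≟ a))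

  Uop-equivariant : (g h : ArcFn n) → (∀ x y → g (σ ⟨$⟩ʳ x) (σ ⟨$⟩ʳ y) ≡ h x y) →
                    ∀ x y → Uop n k A S g (σ ⟨$⟩ʳ x) (σ ⟨$⟩ʳ y) ≡ Uop n k A S h x y
  Uop-equivariant g h g∘σ≡h x y =
    cong₂ _-_ (cong₂ _*_ (cong (λ b → ((+ 2 / 1) * recip k) * ⟦ not b ⟧) (σ-preserves-S y))
                         neighbourSum)
              (g∘σ≡h y x)
    where
    neighbourSum : ΣV n (λ w → ⟦ A (σ ⟨$⟩ʳ y) w ⟧ * g (σ ⟨$⟩ʳ y) w) ≡ ΣV n (λ w → ⟦ A y w ⟧ * h y w)
    neighbourSum = trans (ΣV-permute n σ _)
      (ΣV-cong n (λ w → cong₂ (λ b q → ⟦ b ⟧ * q) (σ-preserves-A y w) (g∘σ≡h y w)))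

  Upow-equivariant : ∀ t a x y →
    Upow n k A S t (yv n (σ ⟨$⟩ʳ a)) (σ ⟨$⟩ʳ x) (σ ⟨$⟩ʳ y) ≡ Upow n k A S t (yv n a) x y
  Upow-equivariant zero    a = yv-equivariant a
  Upow-equivariant (suc t) a =
    Uop-equivariant (Upow n k A S t (yv n (σ ⟨$⟩ʳ a))) (Upow n k A S t (yv n a))
                    (Upow-equivariant t a)

  mixTerm-invariant : ∀ t u a → mixTerm n k A S t (σ ⟨$⟩ʳ u) (σ ⟨$⟩ʳ a) ≡ mixTerm n k A S t u a
  mixTerm-invariant t u a = cong (recip k *_) (trans (ΣV-permute n σ _)
    (ΣV-cong n (λ w → cong₂ (λ b q → ⟦ b ⟧ * (q * q)) (σ-preserves-A u w) (Upow-equivariant t a u w))))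

  avgMix-invariant : ∀ m u a → avgMix n k A S m (σ ⟨$⟩ʳ u) (σ ⟨$⟩ʳ a) ≡ avgMix n k A S m u a
  avgMix-invariant m u a =
    cong (recip (suc m) *_) (Σt-cong (suc m) (λ t → mixTerm-invariant t u a))

corollary4p3 : (n k : ℕ) (A : Fin n → Fin n → Bool) (S : Fin n → Bool)
    → IsSimpleGraph n A → IsRegular n A k → IsConnected n A
    → (∃ λ s → S s ≡ true)
    → (σ : Permutation′ n)
    → (∀ x y → A (σ ⟨$⟩ʳ x) (σ ⟨$⟩ʳ y) ≡ A x y)
    → (∀ x → S (σ ⟨$⟩ʳ x) ≡ S x)
    → (a b u v : Fin n) → σ ⟨$⟩ʳ a ≡ b → σ ⟨$⟩ʳ u ≡ v
    → SameLimit (λ m → avgMix n k A S m u a) (λ m → avgMix n k A S m v b)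
corollary4p3 n k A S _ _ _ _ σ σ-preserves-A σ-preserves-S a _ u _ refl refl =
  sameLimit-≗ (λ m → sym (avgMix-invariant m u a))
  where open Automorphism n k A S σ σ-preserves-A σ-preserves-S
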